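{- Let $\alpha<_c\beta$ be compositions such that $\beta/\!\!/\alpha$ is an nc border strip of size $n$. Then $n-1-|E(\beta/\!\!/\alpha)|=ht(\beta/\!\!/\alpha)$.
   Context: A composition is a finite sequence $\alpha=(\alpha_1,\ldots,\alpha_k)$ of positive integers; $l(\alpha)=k$, $|\alpha|=\sum\alpha_i$; its diagram is the set of boxes $(i,j)$ with $1\le i\le k$, $1\le j\le\alpha_i$ (rows top to bottom, columns left to right). Write $\alpha\lessdot_c\beta$ if $\beta=(1,\alpha_1,\ldots,\alpha_k)$, or $\beta$ is obtained from $\alpha$ by increasing a part $\alpha_m$ by one where $\alpha_i\ne\alpha_m$ for all $i<m$; $<_c$ is the transitive closure. If $\alpha<_c\beta$ and $d=l(\beta)-l(\alpha)$, $\beta/\!\!/\alpha$ is the set of boxes of the diagram of $\beta$ not of the form $(i'+d,j)$ with $j\le\alpha_{i'}$; its size is $|\beta|-|\alpha|$; it is an interval shape if the set of columns containing its boxes is a set of consecutive integers. An interval shape is an nc border strip if (1) whenever $(i,1),(i,2)\in\beta/\!\!/\alpha$, $(i,1)$ is the bottommost box of column 1 of $\beta/\!\!/\alpha$; (2) whenever $(i,j),(i,j+1)\in\beta/\!\!/\alpha$ with $j\ge2$, $(i,j)$ is the topmost box of column $j$ of $\beta/\!\!/\alpha$. Its height $ht(\beta/\!\!/\alpha)$ is one less than the number of rows containing boxes of $\beta/\!\!/\alpha$. $E(\beta/\!\!/\alpha)$ is the set of $j$ such that $(i,j),(i,j+1)\in\beta/\!\!/\alpha$ for some $i$. -}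

module Defs where

open import Data.Nat using (ℕ; zero; suc; _≤_; _<_; _≤ᵇ_; _<ᵇ_; _∸_; _⊔_)
open import Data.Bool using (Bool; true; false; _∧_; not)
open import Data.List using (List; []; _∷_; _++_; length; map; upTo; filter; foldr)
open import Data.Nat.ListAction using (sum)
open import Data.Bool.ListAction using (any)
open import Data.List.Relation.Unary.All using (All)
open import Data.Integer as ℤ using (ℤ)
open import Relation.Binary.PropositionalEquality using (_≡_; _≢_)
open import Relation.Binary.Construct.Closure.Transitive using (TransClosure)
open import Data.Bool.Properties using (_≟_)

IsComposition : List ℕ → Set
IsComposition α = All (λ x → 0 < x) α

size : List ℕ → ℕ
size = sum

-- part l i = α_i (1-indexed), 0 if i is out of range
part : List ℕ → ℕ → ℕ
part []       _             = 0
part (x ∷ xs) zero          = 0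
part (x ∷ xs) (suc zero)    = x
part (x ∷ xs) (suc (suc i)) = part xs (suc i)

data _⋖c_ : List ℕ → List ℕ → Set where
  prepend1 : ∀ α → α ⋖c (1 ∷ α)
  grow     : ∀ pre a post → All (λ x → x ≢ a) pre →
             (pre ++ a ∷ post) ⋖c (pre ++ suc a ∷ post)

_<c_ : List ℕ → List ℕ → Set
_<c_ = TransClosure _⋖c_

-- box (i,j) in the diagram of l (1-indexed rows/columns)
inDiag : List ℕ → ℕ → ℕ → Bool
inDiag l i j = (1 ≤ᵇ i) ∧ ((1 ≤ᵇ j) ∧ (j ≤ᵇ part l i))

-- box (i,j) in β//α : in β and not of the form (i'+d, j) with (i',j) in α,
-- where d = l(β) - l(α)
inSkew : List ℕ → List ℕ → ℕ → ℕ → Bool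
inSkew α β i j = inDiag β i j ∧ not ((d <ᵇ i) ∧ inDiag α (i ∸ d) j)
  where d = length β ∸ length α

-- the ranges [1..l(β)] of rows and [1..max β] of columns (all boxes live there)
rowRange : List ℕ → List ℕ
rowRange β = map suc (upTo (length β))

maxPart : List ℕ → ℕ
maxPart = foldr _⊔_ 0

colRange : List ℕ → List ℕ
colRange β = map suc (upTo (maxPart β))

colOcc : List ℕ → List ℕ → ℕ → Bool
colOcc α β j = any (λ i → inSkew α β i j) (rowRange β)

rowOcc : List ℕ → List ℕ → ℕ → Bool
rowOcc α β i = any (λ j → inSkew α β i j) (colRange β)

IsIntervalShape : List ℕ → List ℕ → Set
IsIntervalShape α β = ∀ j₁ j j₂ → j₁ ≤ j → j ≤ j₂ →
  colOcc α β j₁ ≡ true → colOcc α β j₂ ≡ true → colOcc α β j ≡ true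

IsNCBorderStrip : List ℕ → List ℕ → Set
IsNCBorderStrip α β =
  IsIntervalShape α β
  × (∀ i → inSkew α β i 1 ≡ true → inSkew α β i 2 ≡ true →
       ∀ i' → i < i' → inSkew α β i' 1 ≡ false)
  × (∀ i j → 2 ≤ j → inSkew α β i j ≡ true → inSkew α β i (suc j) ≡ true →
       ∀ i' → i' < i → inSkew α β i' j ≡ false)
  where open import Data.Product using (_×_)

numRows : List ℕ → List ℕ → ℕ
numRows α β = length (filter (λ i → rowOcc α β i ≟ true) (rowRange β))

ht : List ℕ → List ℕ → ℤ
ht α β = ℤ.+ numRows α β ℤ.- ℤ.+ 1

inE : List ℕ → List ℕ → ℕ → Bool
inE α β j = any (λ i → inSkew α β i j ∧ inSkew α β i (suc j)) (rowRange β)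

sizeE : List ℕ → List ℕ → ℕ
sizeE α β = length (filter (λ j → inE α β j ≟ true) (colRange β))

-- Each row of β//α is a run of consecutive boxes, from column lower α β i + 1 to
-- column β_i.  A row with c boxes therefore adds 1 ⊓ c to the number of occupied rows
-- and c ∸ 1 pairs of horizontally adjacent boxes.  The nc conditions forbid two such
-- pairs (i, j), (i, j + 1) in different rows over the same column j, so |E(β//α)| is the
-- total number of adjacent pairs, and n = Σ c = (ht + 1) + |E|.
module Submission where

open import Defs
open import Data.Integer as ℤ using (ℤ)
import Data.Integer.Properties as ℤ
import Data.Integer.Tactic.RingSolver as ℤ-Solver
open import Data.Nat using (ℕ; zero; suc; _+_; _∸_; _⊓_; _≤_; _<_; _<ᵇ_; _≤ᵇ_; z≤n; s≤s)
open import Data.Nat.Properties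
open import Data.Nat.ListAction using (sum)
open import Data.Nat.ListAction.Properties using (sum-++)
open import Data.Bool using (Bool; true; false; _∧_; not; T)
import Data.Bool.Properties as Bool
open import Data.Bool.ListAction using (any)
open import Data.List using (List; []; _∷_; _++_; length; filter; map; upTo; applyUpTo)
open import Data.List.Properties using (map-++; map-upTo; applyUpTo-∷ʳ)
open import Data.Product using (_×_; _,_; proj₁; proj₂)
open import Data.Empty using (⊥; ⊥-elim)
open import Function using (_∘_)
open import Function.Bundles using (_⇔_; mk⇔; Equivalence)
import Function.Properties.Equivalence as ⇔
open import Data.Product.Function.NonDependent.Propositional using (_×-⇔_)
open import Relation.Binary.Construct.Closure.Transitive using ([_]; _∷_)
open import Relation.Binary.Definitions using (tri<; tri≈; tri>)
open import Relation.Nullary using (Dec; yes; no; ¬_)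
open import Relation.Binary.PropositionalEquality
open import Algebra.Properties.CommutativeSemigroup +-commutativeSemigroup using (interchange)

open ≡-Reasoning

𝟙 : Bool → ℕ
𝟙 true  = 1
𝟙 false = 0

length-filter≡sum-𝟙 : ∀ {A : Set} (P : A → Bool) xs →
  length (filter (λ x → P x Bool.≟ true) xs) ≡ sum (map (𝟙 ∘ P) xs)
length-filter≡sum-𝟙 P []       = refl
length-filter≡sum-𝟙 P (x ∷ xs) with P x
... | true  = cong suc (length-filter≡sum-𝟙 P xs)
... | false = length-filter≡sum-𝟙 P xs

𝟙-any : ∀ {A : Set} (P : A → Bool) xs → 𝟙 (any P xs) ≡ 1 ⊓ sum (map (𝟙 ∘ P) xs)
𝟙-any P []       = refl
𝟙-any P (x ∷ xs) with P x
... | true  = refl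
... | false = 𝟙-any P xs

sumTo : ℕ → (ℕ → ℕ) → ℕ
sumTo zero    f = 0
sumTo (suc n) f = sumTo n f + f (suc n)

sum-map-applyUpTo-suc : ∀ f n → sum (map f (applyUpTo suc n)) ≡ sumTo n f
sum-map-applyUpTo-suc f zero    = refl
sum-map-applyUpTo-suc f (suc n) = begin
  sum (map f (applyUpTo suc (suc n)))              ≡⟨ cong (sum ∘ map f) (applyUpTo-∷ʳ suc n) ⟨
  sum (map f (applyUpTo suc n ++ suc n ∷ []))      ≡⟨ cong sum (map-++ f (applyUpTo suc n) _) ⟩
  sum (map f (applyUpTo suc n) ++ f (suc n) ∷ [])  ≡⟨ sum-++ (map f (applyUpTo suc n)) _ ⟩
  sum (map f (applyUpTo suc n)) + (f (suc n) + 0)  ≡⟨ cong₂ _+_ (sum-map-applyUpTo-suc f n) (+-identityʳ _) ⟩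
  sumTo n f + f (suc n)                            ∎

sum-map-range : ∀ f n → sum (map f (map suc (upTo n))) ≡ sumTo n f
sum-map-range f n = trans (cong (sum ∘ map f) (map-upTo suc n)) (sum-map-applyUpTo-suc f n)

sumTo-cong : ∀ {f g} n → (∀ i → 1 ≤ i → i ≤ n → f i ≡ g i) → sumTo n f ≡ sumTo n g
sumTo-cong zero    f≡g = refl
sumTo-cong (suc n) f≡g =
  cong₂ _+_ (sumTo-cong n (λ i 1≤i i≤n → f≡g i 1≤i (m≤n⇒m≤1+n i≤n))) (f≡g (suc n) (s≤s z≤n) ≤-refl)

sumTo-zero : ∀ {f} n → (∀ i → 1 ≤ i → i ≤ n → f i ≡ 0) → sumTo n f ≡ 0
sumTo-zero zero    f≡0 = refl
sumTo-zero (suc n) f≡0 =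
  cong₂ _+_ (sumTo-zero n (λ i 1≤i i≤n → f≡0 i 1≤i (m≤n⇒m≤1+n i≤n))) (f≡0 (suc n) (s≤s z≤n) ≤-refl)

sumTo-+ : ∀ f g n → sumTo n (λ i → f i + g i) ≡ sumTo n f + sumTo n g
sumTo-+ f g zero    = refl
sumTo-+ f g (suc n) =
  trans (cong (_+ (f (suc n) + g (suc n))) (sumTo-+ f g n)) (interchange (sumTo n f) (sumTo n g) _ _)

sumTo-comm : ∀ (g : ℕ → ℕ → ℕ) m n →
  sumTo m (λ j → sumTo n (λ i → g i j)) ≡ sumTo n (λ i → sumTo m (λ j → g i j))
sumTo-comm g zero    n = sym (sumTo-zero n (λ _ _ _ → refl))
sumTo-comm g (suc m) n = begin
  sumTo m (λ j → sumTo n (λ i → g i j)) + sumTo n (λ i → g i (suc m))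
    ≡⟨ cong (_+ sumTo n (λ i → g i (suc m))) (sumTo-comm g m n) ⟩
  sumTo n (λ i → sumTo m (λ j → g i j)) + sumTo n (λ i → g i (suc m))
    ≡⟨ sumTo-+ (λ i → sumTo m (λ j → g i j)) (λ i → g i (suc m)) n ⟨
  sumTo n (λ i → sumTo (suc m) (λ j → g i j)) ∎

sumTo-split : ∀ f m n → sumTo (m + n) f ≡ sumTo m f + sumTo n (λ i → f (m + i))
sumTo-split f m zero    = trans (cong (λ k → sumTo k f) (+-identityʳ m)) (sym (+-identityʳ _))
sumTo-split f m (suc n) = begin
  sumTo (m + suc n) f                                  ≡⟨ cong (λ k → sumTo k f) (+-suc m n) ⟩
  sumTo (m + n) f + f (suc (m + n))                    ≡⟨ cong₂ _+_ (sumTo-split f m n) (cong f (sym (+-suc m n))) ⟩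
  (sumTo m f + sumTo n (λ i → f (m + i))) + f (m + suc n) ≡⟨ +-assoc (sumTo m f) _ _ ⟩
  sumTo m f + sumTo (suc n) (λ i → f (m + i))          ∎

part-zero : ∀ xs → part xs 0 ≡ 0
part-zero []       = refl
part-zero (x ∷ xs) = refl

sumTo-part : ∀ xs → sumTo (length xs) (part xs) ≡ sum xs
sumTo-part []       = refl
sumTo-part (x ∷ xs) = begin
  sumTo (1 + length xs) (part (x ∷ xs))                   ≡⟨ sumTo-split (part (x ∷ xs)) 1 (length xs) ⟩
  x + sumTo (length xs) (λ i → part (x ∷ xs) (suc i))    ≡⟨ cong (x +_) (sumTo-cong (length xs) shift-back) ⟩
  x + sumTo (length xs) (part xs)                         ≡⟨ cong (x +_) (sumTo-part xs) ⟩
  x + sum xs                                              ∎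
  where
  shift-back : ∀ i → 1 ≤ i → i ≤ length xs → part (x ∷ xs) (suc i) ≡ part xs i
  shift-back (suc i) _ _ = refl

𝟙≡1 : ∀ {x} → x ≡ true → 𝟙 x ≡ 1
𝟙≡1 refl = refl

𝟙≡0 : ∀ {x} → x ≢ true → 𝟙 x ≡ 0
𝟙≡0 {false} _      = refl
𝟙≡0 {true}  x≢true = ⊥-elim (x≢true refl)

sumTo-interval : ∀ (P : ℕ → Bool) a b M → (∀ j → P j ≡ true ⇔ (a < j × j ≤ b)) →
  sumTo M (𝟙 ∘ P) ≡ b ⊓ M ∸ a
sumTo-interval P a b zero    P⇔ = sym (trans (cong (_∸ a) (⊓-zeroʳ b)) (0∸n≡0 a))
sumTo-interval P a b (suc M) P⇔ with suc M ≤? b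
... | no  1+M≰b = begin
  sumTo M (𝟙 ∘ P) + 𝟙 (P (suc M))  ≡⟨ cong₂ _+_ (sumTo-interval P a b M P⇔) (𝟙≡0 (1+M≰b ∘ proj₂ ∘ Equivalence.to (P⇔ (suc M)))) ⟩
  b ⊓ M ∸ a + 0                    ≡⟨ +-identityʳ _ ⟩
  b ⊓ M ∸ a                        ≡⟨ cong (_∸ a) (trans (m≤n⇒m⊓n≡m b≤M) (sym (m≤n⇒m⊓n≡m (m≤n⇒m≤1+n b≤M)))) ⟩
  b ⊓ suc M ∸ a                    ∎
  where b≤M = ≤-pred (≰⇒> 1+M≰b)
... | yes 1+M≤b = begin
  sumTo M (𝟙 ∘ P) + 𝟙 (P (suc M))  ≡⟨ cong (_+ 𝟙 (P (suc M))) (sumTo-interval P a b M P⇔) ⟩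
  b ⊓ M ∸ a + 𝟙 (P (suc M))        ≡⟨ cong (λ k → k ∸ a + 𝟙 (P (suc M))) (m≥n⇒m⊓n≡n (M≤b)) ⟩
  M ∸ a + 𝟙 (P (suc M))            ≡⟨ new-point ⟩
  suc M ∸ a                        ≡⟨ cong (_∸ a) (m≥n⇒m⊓n≡n 1+M≤b) ⟨
  b ⊓ suc M ∸ a                    ∎
  where
  M≤b : M ≤ b
  M≤b = ≤-trans (n≤1+n M) 1+M≤b
  new-point : M ∸ a + 𝟙 (P (suc M)) ≡ suc M ∸ a
  new-point with a <? suc M
  ... | yes a<1+M = begin
    M ∸ a + 𝟙 (P (suc M)) ≡⟨ cong (M ∸ a +_) (𝟙≡1 (Equivalence.from (P⇔ (suc M)) (a<1+M , 1+M≤b))) ⟩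
    M ∸ a + 1             ≡⟨ +-comm (M ∸ a) 1 ⟩
    1 + (M ∸ a)           ≡⟨ +-∸-assoc 1 (≤-pred a<1+M) ⟨
    suc M ∸ a             ∎
  ... | no  a≮1+M = begin
    M ∸ a + 𝟙 (P (suc M)) ≡⟨ cong₂ _+_ (m≤n⇒m∸n≡0 (≤-trans (n≤1+n M) a≥1+M)) (𝟙≡0 (a≮1+M ∘ proj₁ ∘ Equivalence.to (P⇔ (suc M)))) ⟩
    0                     ≡⟨ m≤n⇒m∸n≡0 a≥1+M ⟨
    suc M ∸ a             ∎
    where a≥1+M = ≮⇒≥ a≮1+M

sumTo-𝟙-unique : ∀ (P : ℕ → Bool) n → (∀ i i' → P i ≡ true → P i' ≡ true → i ≡ i') →
  sumTo n (𝟙 ∘ P) ≤ 1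
sumTo-𝟙-unique P zero    unique = z≤n
sumTo-𝟙-unique P (suc n) unique with P (suc n) in Pn
... | false = subst (_≤ 1) (sym (+-identityʳ _)) (sumTo-𝟙-unique P n unique)
... | true  = ≤-reflexive (cong (_+ 1) (sumTo-zero n none-before))
  where
  none-before : ∀ i → 1 ≤ i → i ≤ n → 𝟙 (P i) ≡ 0
  none-before i _ i≤n = 𝟙≡0 (λ Pi → <⇒≢ (s≤s i≤n) (unique i (suc n) Pi Pn))

shift : List ℕ → List ℕ → ℕ
shift α β = length β ∸ length α

-- Row i of β//α is the run of columns lower α β i < j ≤ part β i; for the rows
-- above the translate of α, i ∸ shift α β = 0 and part α 0 = 0.
lower : List ℕ → List ℕ → ℕ → ℕ
lower α β i = part α (i ∸ shift α β)

rowLength : List ℕ → List ℕ → ℕ → ℕ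
rowLength α β i = part β i ∸ lower α β i

∧≡true⇔ : ∀ {x y} → x ∧ y ≡ true ⇔ (x ≡ true × y ≡ true)
∧≡true⇔ {true}  {true}  = mk⇔ (λ _ → refl , refl) (λ _ → refl)
∧≡true⇔ {true}  {false} = mk⇔ (λ ()) (λ ())
∧≡true⇔ {false}         = mk⇔ (λ ()) (λ ())

∧-not≡true⇔ : ∀ {x y} → x ∧ not y ≡ true ⇔ (x ≡ true × ¬ y ≡ true)
∧-not≡true⇔ {true}  {false} = mk⇔ (λ _ → refl , λ ()) (λ _ → refl)
∧-not≡true⇔ {true}  {true}  = mk⇔ (λ ()) (λ (_ , y≢true) → ⊥-elim (y≢true refl))
∧-not≡true⇔ {false}         = mk⇔ (λ ()) (λ ())

≤ᵇ≡true⇔ : ∀ {m n} → (m ≤ᵇ n) ≡ true ⇔ m ≤ n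
≤ᵇ≡true⇔ {m} {n} = mk⇔ (≤ᵇ⇒≤ m n ∘ Equivalence.from Bool.T-≡) (Equivalence.to Bool.T-≡ ∘ ≤⇒≤ᵇ)

inDiag⇔ : ∀ l i j → inDiag l i j ≡ true ⇔ (1 ≤ j × j ≤ part l i)
inDiag⇔ l zero    j = mk⇔ (λ ()) (λ (1≤j , j≤0) → ⊥-elim (<⇒≱ 1≤j (subst (j ≤_) (part-zero l) j≤0)))
inDiag⇔ l (suc i) j = ⇔.trans ∧≡true⇔ (≤ᵇ≡true⇔ ×-⇔ ≤ᵇ≡true⇔)

inDiag-below : ∀ l d i j → (d <ᵇ i) ∧ inDiag l (i ∸ d) j ≡ inDiag l (i ∸ d) j
inDiag-below l d i j with d <ᵇ i in d<ᵇi
... | true  = refl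
... | false = cong (λ k → inDiag l k j) (sym (m≤n⇒m∸n≡0 i≤d))
  where
  i≤d : i ≤ d
  i≤d = ≮⇒≥ (λ d<i → subst T d<ᵇi (<⇒<ᵇ d<i))

inSkew⇔ : ∀ α β i j → inSkew α β i j ≡ true ⇔ (lower α β i < j × j ≤ part β i)
inSkew⇔ α β i j = ⇔.trans (mk⇔ (trans (sym skew≡)) (trans skew≡)) (⇔.trans ∧-not≡true⇔ (mk⇔ to from))
  where
  skew≡ : inSkew α β i j ≡ inDiag β i j ∧ not (inDiag α (i ∸ shift α β) j)
  skew≡ = cong (λ b → inDiag β i j ∧ not b) (inDiag-below α (shift α β) i j)
  inα⇔ = inDiag⇔ α (i ∸ shift α β) j
  inβ⇔ = inDiag⇔ β i j
  to : inDiag β i j ≡ true × ¬ inDiag α (i ∸ shift α β) j ≡ true → lower α β i < j × j ≤ part β i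
  to (inβ , ∉α) with 1≤j , j≤B ← Equivalence.to inβ⇔ inβ =
    ≰⇒> (λ j≤A → ∉α (Equivalence.from inα⇔ (1≤j , j≤A))) , j≤B
  from : lower α β i < j × j ≤ part β i → inDiag β i j ≡ true × ¬ inDiag α (i ∸ shift α β) j ≡ true
  from (A<j , j≤B) =
    Equivalence.from inβ⇔ (≤-trans (s≤s z≤n) A<j , j≤B) , λ inα → <⇒≱ A<j (proj₂ (Equivalence.to inα⇔ inα))

rowPair : List ℕ → List ℕ → ℕ → ℕ → Bool
rowPair α β i j = inSkew α β i j ∧ inSkew α β i (suc j)

rowPair⇔ : ∀ α β i j → rowPair α β i j ≡ true ⇔ (lower α β i < j × j ≤ part β i ∸ 1)
rowPair⇔ α β i j = ⇔.trans ∧≡true⇔ (⇔.trans (inSkew⇔ α β i j ×-⇔ inSkew⇔ α β i (suc j)) (mk⇔ to from))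
  where
  A = lower α β i
  B = part β i
  to : (A < j × j ≤ B) × (A < suc j × suc j ≤ B) → A < j × j ≤ B ∸ 1
  to ((A<j , _) , (_ , 1+j≤B)) = A<j , ∸-monoˡ-≤ 1 1+j≤B
  from : A < j × j ≤ B ∸ 1 → (A < j × j ≤ B) × (A < suc j × suc j ≤ B)
  from (A<j , j≤B∸1) = (A<j , ≤-trans (n≤1+n j) 1+j≤B) , (m≤n⇒m≤1+n A<j , 1+j≤B)
    where
    1≤B : 1 ≤ B
    1≤B = ≤-trans (≤-trans (s≤s z≤n) A<j) (≤-trans j≤B∸1 (m∸n≤m B 1))
    1+j≤B : suc j ≤ B
    1+j≤B = subst (_≤ B) (+-comm j 1) (m≤o∸n⇒m+n≤o j 1≤B j≤B∸1)

rowPair⇒inSkew : ∀ α β i j → rowPair α β i j ≡ true →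
  inSkew α β i j ≡ true × inSkew α β i (suc j) ≡ true
rowPair⇒inSkew α β i j = Equivalence.to ∧≡true⇔

part≤maxPart : ∀ xs i → part xs i ≤ maxPart xs
part≤maxPart []       i             = z≤n
part≤maxPart (x ∷ xs) zero          = z≤n
part≤maxPart (x ∷ xs) (suc zero)    = m≤m⊔n x _
part≤maxPart (x ∷ xs) (suc (suc i)) = ≤-trans (part≤maxPart xs (suc i)) (m≤n⊔m x _)

sumTo-inSkew : ∀ α β i → sumTo (maxPart β) (λ j → 𝟙 (inSkew α β i j)) ≡ rowLength α β i
sumTo-inSkew α β i =
  trans (sumTo-interval (inSkew α β i) (lower α β i) (part β i) (maxPart β) (inSkew⇔ α β i))
        (cong (_∸ lower α β i) (m≤n⇒m⊓n≡m (part≤maxPart β i)))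

sumTo-rowPair : ∀ α β i → sumTo (maxPart β) (λ j → 𝟙 (rowPair α β i j)) ≡ rowLength α β i ∸ 1
sumTo-rowPair α β i = begin
  sumTo (maxPart β) (λ j → 𝟙 (rowPair α β i j)) ≡⟨ sumTo-interval (rowPair α β i) A (B ∸ 1) (maxPart β) (rowPair⇔ α β i) ⟩
  (B ∸ 1) ⊓ maxPart β ∸ A                       ≡⟨ cong (_∸ A) (m≤n⇒m⊓n≡m (≤-trans (m∸n≤m B 1) (part≤maxPart β i))) ⟩
  B ∸ 1 ∸ A                                     ≡⟨ ∸-+-assoc B 1 A ⟩
  B ∸ (1 + A)                                   ≡⟨ cong (B ∸_) (+-comm 1 A) ⟩
  B ∸ (A + 1)                                   ≡⟨ ∸-+-assoc B A 1 ⟨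
  B ∸ A ∸ 1                                     ∎
  where
  A = lower α β i
  B = part β i

record _⊑_ (α β : List ℕ) : Set where
  constructor translate
  field
    offset  : ℕ
    length≡ : length β ≡ offset + length α
    fits    : ∀ i → part α i ≤ part β (i + offset)

part-grow : ∀ (pre : List ℕ) a post i → part (pre ++ a ∷ post) i ≤ part (pre ++ suc a ∷ post) i
part-grow []        a post zero          = z≤n
part-grow []        a post (suc zero)    = n≤1+n a
part-grow []        a post (suc (suc i)) = ≤-refl
part-grow (x ∷ pre) a post zero          = z≤n
part-grow (x ∷ pre) a post (suc zero)    = ≤-refl
part-grow (x ∷ pre) a post (suc (suc i)) = part-grow pre a post (suc i)

length-grow : ∀ (pre : List ℕ) a post → length (pre ++ suc a ∷ post) ≡ length (pre ++ a ∷ post)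
length-grow []        a post = refl
length-grow (x ∷ pre) a post = cong suc (length-grow pre a post)

⋖c⇒⊑ : ∀ {α β} → α ⋖c β → α ⊑ β
⋖c⇒⊑ (prepend1 α)          = translate 1 refl λ i → subst (λ k → part α i ≤ part (1 ∷ α) k) (+-comm 1 i) (below i)
  where
  below : ∀ i → part α i ≤ part (1 ∷ α) (suc i)
  below zero    = ≤-trans (≤-reflexive (part-zero α)) z≤n
  below (suc i) = ≤-refl
⋖c⇒⊑ (grow pre a post _) =
  translate 0 (length-grow pre a post) λ i →
    subst (λ k → part (pre ++ a ∷ post) i ≤ part (pre ++ suc a ∷ post) k) (sym (+-identityʳ i)) (part-grow pre a post i)

⊑-trans : ∀ {α β γ} → α ⊑ β → β ⊑ γ → α ⊑ γ
⊑-trans {α} {β} {γ} (translate k lβ α⊑β) (translate k' lγ β⊑γ) = translate (k + k') length≡ fits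
  where
  length≡ : length γ ≡ (k + k') + length α
  length≡ = begin
    length γ             ≡⟨ lγ ⟩
    k' + length β        ≡⟨ cong (k' +_) lβ ⟩
    k' + (k + length α)  ≡⟨ +-assoc k' k _ ⟨
    (k' + k) + length α  ≡⟨ cong (_+ length α) (+-comm k' k) ⟩
    (k + k') + length α  ∎
  fits : ∀ i → part α i ≤ part γ (i + (k + k'))
  fits i = subst (λ m → part α i ≤ part γ m) (+-assoc i k k') (≤-trans (α⊑β i) (β⊑γ (i + k)))

<c⇒⊑ : ∀ {α β} → α <c β → α ⊑ β
<c⇒⊑ [ α⋖β ]     = ⋖c⇒⊑ α⋖β
<c⇒⊑ (α⋖γ ∷ γ<β) = ⊑-trans (⋖c⇒⊑ α⋖γ) (<c⇒⊑ γ<β)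

shift≡offset : ∀ {α β} (α⊑β : α ⊑ β) → shift α β ≡ _⊑_.offset α⊑β
shift≡offset {α} (translate k lβ _) = trans (cong (_∸ length α) lβ) (m+n∸n≡m k (length α))

lower≤part : ∀ {α β} → α ⊑ β → ∀ i → lower α β i ≤ part β i
lower≤part {α} {β} α⊑β@(translate k _ fits) i =
  subst (λ d → part α (i ∸ d) ≤ part β i) (sym (shift≡offset α⊑β)) (by-cases (k ≤? i))
  where
  by-cases : Dec (k ≤ i) → part α (i ∸ k) ≤ part β i
  by-cases (yes k≤i) = subst (λ m → part α (i ∸ k) ≤ part β m) (m∸n+n≡m k≤i) (fits (i ∸ k))
  by-cases (no  k≰i) = ≤-trans (≤-reflexive (trans (cong (part α) i∸k≡0) (part-zero α))) z≤n
    where i∸k≡0 = m≤n⇒m∸n≡0 (<⇒≤ (≰⇒> k≰i))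

sumTo-lower : ∀ {α β} → α ⊑ β → sumTo (length β) (lower α β) ≡ size α
sumTo-lower {α} {β} α⊑β@(translate k lβ _) = begin
  sumTo (length β) (lower α β)                                       ≡⟨ cong (λ m → sumTo m (lower α β)) lβ ⟩
  sumTo (k + length α) (lower α β)                                   ≡⟨ sumTo-split (lower α β) k (length α) ⟩
  sumTo k (lower α β) + sumTo (length α) (λ i → lower α β (k + i))   ≡⟨ cong₂ _+_ (sumTo-zero k above) (sumTo-cong (length α) inside) ⟩
  0 + sumTo (length α) (part α)                                      ≡⟨ sumTo-part α ⟩
  size α                                                             ∎
  where
  lower≡ : ∀ i → lower α β i ≡ part α (i ∸ k)
  lower≡ i = cong (λ d → part α (i ∸ d)) (shift≡offset α⊑β)
  above : ∀ i → 1 ≤ i → i ≤ k → lower α β i ≡ 0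
  above i _ i≤k = trans (lower≡ i) (trans (cong (part α) (m≤n⇒m∸n≡0 i≤k)) (part-zero α))
  inside : ∀ i → 1 ≤ i → i ≤ length α → lower α β (k + i) ≡ part α i
  inside i _ _ = trans (lower≡ (k + i)) (cong (part α) (m+n∸m≡n k i))

sumTo-rowLength : ∀ {α β} → α ⊑ β → sumTo (length β) (rowLength α β) + size α ≡ size β
sumTo-rowLength {α} {β} α⊑β = begin
  sumTo L (rowLength α β) + size α                    ≡⟨ cong (sumTo L (rowLength α β) +_) (sumTo-lower α⊑β) ⟨
  sumTo L (rowLength α β) + sumTo L (lower α β)       ≡⟨ sumTo-+ (rowLength α β) (lower α β) L ⟨
  sumTo L (λ i → rowLength α β i + lower α β i)       ≡⟨ sumTo-cong L (λ i _ _ → m∸n+n≡m (lower≤part α⊑β i)) ⟩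
  sumTo L (part β)                                    ≡⟨ sumTo-part β ⟩
  size β                                              ∎
  where L = length β

-- Condition (1) of an nc border strip handles column 1, condition (2) the columns j ≥ 2.
no-rowPair-below : ∀ {α β} → IsNCBorderStrip α β → ∀ j {i i'} →
  rowPair α β i j ≡ true → rowPair α β i' j ≡ true → i < i' → ⊥
no-rowPair-below {α} {β} _ zero {i} p _ _ =
  n≮0 (proj₁ (Equivalence.to (inSkew⇔ α β i 0) (proj₁ (rowPair⇒inSkew α β i 0 p))))
no-rowPair-below {α} {β} (_ , col1 , _) (suc zero) {i} {i'} p p' i<i'
  with ∈i1 , ∈i2 ← rowPair⇒inSkew α β i 1 p | ∈i'1 , _ ← rowPair⇒inSkew α β i' 1 p' =
  Bool.not-¬ ∈i'1 (col1 i ∈i1 ∈i2 i' i<i')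
no-rowPair-below {α} {β} (_ , _ , colj) j@(suc (suc _)) {i} {i'} p p' i<i'
  with ∈ij , _ ← rowPair⇒inSkew α β i j p | ∈i'j , ∈i'j+1 ← rowPair⇒inSkew α β i' j p' =
  Bool.not-¬ ∈ij (colj i' j (s≤s (s≤s z≤n)) ∈i'j ∈i'j+1 i i<i')

rowPair-unique : ∀ α β → IsNCBorderStrip α β → ∀ j i i' →
  rowPair α β i j ≡ true → rowPair α β i' j ≡ true → i ≡ i'
rowPair-unique α β nc j i i' p p' with <-cmp i i'
... | tri< i<i' _ _ = ⊥-elim (no-rowPair-below {α} {β} nc j p p' i<i')
... | tri≈ _ i≡i' _ = i≡i'
... | tri> _ _ i'<i = ⊥-elim (no-rowPair-below {α} {β} nc j p' p i'<i)

numRows≡sumTo : ∀ α β → numRows α β ≡ sumTo (length β) (λ i → 1 ⊓ rowLength α β i)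
numRows≡sumTo α β = begin
  numRows α β                                       ≡⟨ length-filter≡sum-𝟙 (rowOcc α β) (rowRange β) ⟩
  sum (map (𝟙 ∘ rowOcc α β) (rowRange β))           ≡⟨ sum-map-range (𝟙 ∘ rowOcc α β) (length β) ⟩
  sumTo (length β) (𝟙 ∘ rowOcc α β)                 ≡⟨ sumTo-cong (length β) (λ i _ _ → occupied i) ⟩
  sumTo (length β) (λ i → 1 ⊓ rowLength α β i)      ∎
  where
  occupied : ∀ i → 𝟙 (rowOcc α β i) ≡ 1 ⊓ rowLength α β i
  occupied i = begin
    𝟙 (rowOcc α β i)                                          ≡⟨ 𝟙-any (inSkew α β i) (colRange β) ⟩
    1 ⊓ sum (map (𝟙 ∘ inSkew α β i) (colRange β))             ≡⟨ cong (1 ⊓_) (sum-map-range (𝟙 ∘ inSkew α β i) (maxPart β)) ⟩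
    1 ⊓ sumTo (maxPart β) (𝟙 ∘ inSkew α β i)                  ≡⟨ cong (1 ⊓_) (sumTo-inSkew α β i) ⟩
    1 ⊓ rowLength α β i                                       ∎

-- Each j ∈ E(β//α) is witnessed by exactly one row, so |E| counts the pairs of adjacent boxes.
sizeE≡sumTo : ∀ α β → IsNCBorderStrip α β → sizeE α β ≡ sumTo (length β) (λ i → rowLength α β i ∸ 1)
sizeE≡sumTo α β nc = begin
  sizeE α β                                                          ≡⟨ length-filter≡sum-𝟙 (inE α β) (colRange β) ⟩
  sum (map (𝟙 ∘ inE α β) (colRange β))                               ≡⟨ sum-map-range (𝟙 ∘ inE α β) M ⟩
  sumTo M (𝟙 ∘ inE α β)                                              ≡⟨ sumTo-cong M (λ j _ _ → witnesses j) ⟩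
  sumTo M (λ j → sumTo L (λ i → 𝟙 (rowPair α β i j)))                ≡⟨ sumTo-comm (λ i j → 𝟙 (rowPair α β i j)) M L ⟩
  sumTo L (λ i → sumTo M (λ j → 𝟙 (rowPair α β i j)))                ≡⟨ sumTo-cong L (λ i _ _ → sumTo-rowPair α β i) ⟩
  sumTo L (λ i → rowLength α β i ∸ 1)                                ∎
  where
  L = length β
  M = maxPart β
  witnesses : ∀ j → 𝟙 (inE α β j) ≡ sumTo L (λ i → 𝟙 (rowPair α β i j))
  witnesses j = begin
    𝟙 (inE α β j)                                                    ≡⟨ 𝟙-any (λ i → rowPair α β i j) (rowRange β) ⟩
    1 ⊓ sum (map (λ i → 𝟙 (rowPair α β i j)) (rowRange β))           ≡⟨ cong (1 ⊓_) (sum-map-range (λ i → 𝟙 (rowPair α β i j)) L) ⟩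
    1 ⊓ sumTo L (λ i → 𝟙 (rowPair α β i j))                          ≡⟨ m≥n⇒m⊓n≡n (sumTo-𝟙-unique (λ i → rowPair α β i j) L (rowPair-unique α β nc j)) ⟩
    sumTo L (λ i → 𝟙 (rowPair α β i j))                              ∎

size≡numRows+sizeE : ∀ α β n → α <c β → IsNCBorderStrip α β → size α + n ≡ size β →
  n ≡ numRows α β + sizeE α β
size≡numRows+sizeE α β n α<β nc |α|+n≡|β| = begin
  n                                                       ≡⟨ +-cancelʳ-≡ (size α) n _ n+|α|≡ ⟩
  sumTo L (rowLength α β)                                 ≡⟨ sumTo-cong L (λ i _ _ → m⊓n+n∸m≡n 1 (rowLength α β i)) ⟨
  sumTo L (λ i → 1 ⊓ rowLength α β i + (rowLength α β i ∸ 1))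
    ≡⟨ sumTo-+ (λ i → 1 ⊓ rowLength α β i) (λ i → rowLength α β i ∸ 1) L ⟩
  sumTo L (λ i → 1 ⊓ rowLength α β i) + sumTo L (λ i → rowLength α β i ∸ 1)
    ≡⟨ cong₂ _+_ (numRows≡sumTo α β) (sizeE≡sumTo α β nc) ⟨
  numRows α β + sizeE α β                                 ∎
  where
  L = length β
  n+|α|≡ : n + size α ≡ sumTo L (rowLength α β) + size α
  n+|α|≡ = trans (+-comm n (size α)) (trans |α|+n≡|β| (sym (sumTo-rowLength (<c⇒⊑ α<β))))

+[m+n]-1-n≡+m-1 : ∀ m n → ℤ.+ (m + n) ℤ.- ℤ.+ 1 ℤ.- ℤ.+ n ≡ ℤ.+ m ℤ.- ℤ.+ 1
+[m+n]-1-n≡+m-1 m n = trans (cong (λ k → k ℤ.- ℤ.+ 1 ℤ.- ℤ.+ n) (ℤ.pos-+ m n)) (cancel (ℤ.+ m) (ℤ.+ n))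
  where
  cancel : ∀ (r e : ℤ) → r ℤ.+ e ℤ.- ℤ.+ 1 ℤ.- e ≡ r ℤ.- ℤ.+ 1
  cancel = ℤ-Solver.solve-∀

lemma5p18 : (α β : List ℕ) (n : ℕ) →
    IsComposition α → IsComposition β → α <c β →
    IsNCBorderStrip α β → size α + n ≡ size β →
    (ℤ.+ n) ℤ.- ℤ.+ 1 ℤ.- ℤ.+ (sizeE α β) ≡ ht α β
lemma5p18 α β n _ _ α<β nc |α|+n≡|β| = begin
  ℤ.+ n ℤ.- ℤ.+ 1 ℤ.- ℤ.+ sizeE α β
    ≡⟨ cong (λ k → ℤ.+ k ℤ.- ℤ.+ 1 ℤ.- ℤ.+ sizeE α β) (size≡numRows+sizeE α β n α<β nc |α|+n≡|β|) ⟩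
  ℤ.+ (numRows α β + sizeE α β) ℤ.- ℤ.+ 1 ℤ.- ℤ.+ sizeE α β
    ≡⟨ +[m+n]-1-n≡+m-1 (numRows α β) (sizeE α β) ⟩
  ht α β ∎
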